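{- Let $\mathbf A$ be a semi-Heyting algebra satisfying $(x^*\to x)^*\approx1$, and let $x\in A$. Then $x^*\to1=x^*$.
   Context: A semi-Heyting algebra is an algebra $\langle A;\wedge,\vee,\to,0,1\rangle$ such that $\langle A;\wedge,\vee,0,1\rangle$ is a bounded lattice and the identities $x\wedge(x\to y)\approx x\wedge y$, $x\wedge(y\to z)\approx x\wedge((x\wedge y)\to(x\wedge z))$, $x\to x\approx1$ hold. Write $x^*:=x\to0$. -}

module Defs where

open import Level using (Level; _⊔_) renaming (suc to lsuc)
open import Relation.Binary.Core using (Rel)
open import Algebra.Core using (Op₂)
open import Algebra.Lattice.Structures using (IsLattice)

record SemiHeytingAlgebra (c ℓ : Level) : Set (lsuc (c ⊔ ℓ)) where
  infixr 5 _⇒_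
  infixr 7 _∧_
  infixr 6 _∨_
  infix  4 _≈_
  field
    Carrier   : Set c
    _≈_       : Rel Carrier ℓ
    _∨_       : Op₂ Carrier
    _∧_       : Op₂ Carrier
    _⇒_       : Op₂ Carrier
    ⊥         : Carrier
    ⊤         : Carrier
    isLattice : IsLattice _≈_ _∨_ _∧_
    ⇒-cong    : ∀ {x y u v} → x ≈ y → u ≈ v → (x ⇒ u) ≈ (y ⇒ v)
    ⊥-bottom  : ∀ x → ⊥ ∧ x ≈ ⊥
    ⊤-top     : ∀ x → ⊤ ∧ x ≈ x
    sh-1      : ∀ x y → x ∧ (x ⇒ y) ≈ x ∧ y
    sh-2      : ∀ x y z → x ∧ (y ⇒ z) ≈ x ∧ ((x ∧ y) ⇒ (x ∧ z))
    sh-3      : ∀ x → x ⇒ x ≈ ⊤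

  open IsLattice isLattice public

  _* : Carrier → Carrier
  x * = x ⇒ ⊥

{-# OPTIONS --safe #-}
-- Taking x = ⊤ in the hypothesis, and using ⊤* ≈ ⊥ and that y* ≈ ⊤ forces
-- y ≈ ⊥, gives ⊥ → ⊤ ≈ ⊥. Since x ∧ x* ≈ ⊥, the relativisation identity
-- x ∧ (y → z) ≈ x ∧ ((x ∧ y) → (x ∧ z)) turns x ∧ (x* → ⊤) into
-- x ∧ (⊥ → ⊤) ≈ ⊥, so x* → ⊤ lies below x*. Conversely every y lies
-- below y → ⊤.
module Submission where

open import Defs
open import Level using (Level)
open import Algebra.Lattice.Bundles using (Lattice)
import Algebra.Lattice.Properties.Lattice as LatticeProperties
open import Relation.Binary.Bundles using (Poset)
import Relation.Binary.Reasoning.Setoid as ≈-Reasoning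

module SemiHeytingProperties {c ℓ : Level} (A : SemiHeytingAlgebra c ℓ) where

  open SemiHeytingAlgebra A

  lattice : Lattice c ℓ
  lattice = record { isLattice = isLattice }

  open Lattice lattice public using (setoid)
  open LatticeProperties lattice using (poset)
  open Poset poset public using (_≤_; antisym)
  open ≈-Reasoning setoid

  ∧-identityʳ : ∀ x → x ∧ ⊤ ≈ x
  ∧-identityʳ x = trans (∧-comm x ⊤) (⊤-top x)

  ∧-zeroʳ : ∀ x → x ∧ ⊥ ≈ ⊥
  ∧-zeroʳ x = trans (∧-comm x ⊥) (⊥-bottom x)

  x∧x*≈⊥ : ∀ x → x ∧ x * ≈ ⊥
  x∧x*≈⊥ x = trans (sh-1 x ⊥) (∧-zeroʳ x)

  ⊤*≈⊥ : ⊤ * ≈ ⊥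
  ⊤*≈⊥ = trans (sym (⊤-top (⊤ *))) (x∧x*≈⊥ ⊤)

  *≈⊤⇒≈⊥ : ∀ {x} → x * ≈ ⊤ → x ≈ ⊥
  *≈⊤⇒≈⊥ {x} x*≈⊤ = begin
    x       ≈⟨ ∧-identityʳ x ⟨
    x ∧ ⊤   ≈⟨ ∧-congˡ x*≈⊤ ⟨
    x ∧ x * ≈⟨ x∧x*≈⊥ x ⟩
    ⊥       ∎

  x∧[x*⇒y]≈x∧[⊥⇒y] : ∀ x y → x ∧ (x * ⇒ y) ≈ x ∧ (⊥ ⇒ y)
  x∧[x*⇒y]≈x∧[⊥⇒y] x y = begin
    x ∧ (x * ⇒ y)                ≈⟨ sh-2 x (x *) y ⟩
    x ∧ ((x ∧ x *) ⇒ (x ∧ y))    ≈⟨ ∧-congˡ (⇒-cong x∧x*≈x∧⊥ refl) ⟩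
    x ∧ ((x ∧ ⊥) ⇒ (x ∧ y))      ≈⟨ sh-2 x ⊥ y ⟨
    x ∧ (⊥ ⇒ y)                  ∎
    where
    x∧x*≈x∧⊥ : x ∧ x * ≈ x ∧ ⊥
    x∧x*≈x∧⊥ = trans (x∧x*≈⊥ x) (sym (∧-zeroʳ x))

  disjoint⇒≤* : ∀ {x y} → x ∧ y ≈ ⊥ → y ≤ x *
  disjoint⇒≤* {x} {y} x∧y≈⊥ = sym (begin
    y ∧ (x ⇒ ⊥)                  ≈⟨ sh-2 y x ⊥ ⟩
    y ∧ ((y ∧ x) ⇒ (y ∧ ⊥))      ≈⟨ ∧-congˡ (⇒-cong y∧x≈⊥ (∧-zeroʳ y)) ⟩
    y ∧ (⊥ ⇒ ⊥)                  ≈⟨ ∧-congˡ (sh-3 ⊥) ⟩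
    y ∧ ⊤                        ≈⟨ ∧-identityʳ y ⟩
    y                            ∎)
    where
    y∧x≈⊥ : y ∧ x ≈ ⊥
    y∧x≈⊥ = trans (∧-comm y x) x∧y≈⊥

  x≤x⇒⊤ : ∀ x → x ≤ x ⇒ ⊤
  x≤x⇒⊤ x = sym (trans (sh-1 x ⊤) (∧-identityʳ x))

lemma8p2 : ∀ {c ℓ : Level} (A : SemiHeytingAlgebra c ℓ) →
             let open SemiHeytingAlgebra A in
             (∀ x → ((x *) ⇒ x) * ≈ ⊤) →
             ∀ x → (x *) ⇒ ⊤ ≈ x *
lemma8p2 A hyp x = antisym (disjoint⇒≤* x∧[x*⇒⊤]≈⊥) (x≤x⇒⊤ (x *))
  where
  open SemiHeytingAlgebra A
  open SemiHeytingProperties A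
  open ≈-Reasoning setoid

  ⊥⇒⊤≈⊥ : ⊥ ⇒ ⊤ ≈ ⊥
  ⊥⇒⊤≈⊥ = trans (⇒-cong (sym ⊤*≈⊥) refl) (*≈⊤⇒≈⊥ (hyp ⊤))

  x∧[x*⇒⊤]≈⊥ : x ∧ (x * ⇒ ⊤) ≈ ⊥
  x∧[x*⇒⊤]≈⊥ = begin
    x ∧ (x * ⇒ ⊤)  ≈⟨ x∧[x*⇒y]≈x∧[⊥⇒y] x ⊤ ⟩
    x ∧ (⊥ ⇒ ⊤)    ≈⟨ ∧-congˡ ⊥⇒⊤≈⊥ ⟩
    x ∧ ⊥          ≈⟨ ∧-zeroʳ x ⟩
    ⊥              ∎
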